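{- Let $L$ be a lattice (with join $+$, meet $\cdot$, order $\le$) equipped with a unary operation $-$, and let $M=\langle W,R,s\rangle$ and $M'=\langle W',R',s'\rangle$ be many-logic modal $L$-structures. Let $B\subseteq W\times W'$ be a bisimulation between $M$ and $M'$. Then for every pair $(w,w')\in B$ and every formula $\varphi$ of the modal propositional language (built from propositional variables with $\neg,\wedge,\vee,\Box,\Diamond$), we have $v_w(\varphi)=v_{w'}(\varphi)$.
   Context: A many-logic modal $L$-structure is a triple $M=\langle W,R,s\rangle$ where: each world $w\in W$ is a pair $\langle i,L_i\rangle$ with $i$ an identifier and $L_i$ a complete sublattice of $L$ (we write $L_w$ for the sublattice of $w$); $R\subseteq W\times W$ is the accessibility relation; and $s$ assigns to each world $w$ and each propositional variable $p$ a value $s(w,p)\in L_w$. Down-interpretation: for a complete sublattice $L'$ of $L$ and $a\in L$, $a^{L'}$ is the join, computed in $L'$, of $\{x\in L' : x\le a\}$; if this set is empty, $a^{L'}$ is the least element of $L'$. (If $a\in L'$ then $a^{L'}=a$.) Valuation at a world $w$ (with values in $L_w$): $v_w(p)=s(w,p)$ for propositional variables $p$; $v_w(\neg\varphi)=(-v_w(\varphi))^{L_w}$; $v_w(\varphi\vee\psi)=(v_w(\varphi)+v_w(\psi))^{L_w}$; $v_w(\varphi\wedge\psi)=(v_w(\varphi)\cdot v_w(\psi))^{L_w}$; $v_w(\Box\varphi)$ is the meet, computed in $L_w$, of the set $\{(v_u(\varphi))^{L_w} : u\in W,\ wRu\}$; and $v_w(\Diamond\varphi)=(-v_w(\Box\neg\varphi))^{L_w}$.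 Bisimulation: a relation $B\subseteq W\times W'$ such that every pair $(w,w')\in B$ has $L_w=L_{w'}$ (same sublattice) and satisfies: (Atomic) $v_w(p)=v_{w'}(p)$ for every propositional variable $p$; (Zig) if $wRu$ for some $u\in W$, then there is $u'\in W'$ with $L_{u'}=L_u$, $w'R'u'$ and $(u,u')\in B$; (Zag) if $w'R'u'$ for some $u'\in W'$, then there is $u\in W$ with $L_u=L_{u'}$, $wRu$ and $(u,u')\in B$. -}

module Defs where

open import Level using (Level; suc; _⊔_)
open import Data.Nat using (ℕ)
open import Data.Product using (Σ; _×_; ∃; _,_)
open import Function.Bundles using (_⇔_)
open import Relation.Binary.Core using (Rel)
open import Relation.Binary.Lattice.Bundles using (Lattice)
open import Relation.Unary using (Pred)

Var : Set
Var = ℕ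

data Formula : Set where
  var  : Var → Formula
  ¬'_  : Formula → Formula
  _∧'_ : Formula → Formula → Formula
  _∨'_ : Formula → Formula → Formula
  □_   : Formula → Formula
  ◇_   : Formula → Formula

module _ {a : Level} (L : Lattice a a a) where
  open Lattice L

  record CSL : Set (suc a) where
    field
      mem      : Pred Carrier a
      mem-resp : ∀ {x y} → x ≈ y → mem x → mem y
      ∨-closed : ∀ {x y} → mem x → mem y → mem (x ∨ y)
      ∧-closed : ∀ {x y} → mem x → mem y → mem (x ∧ y)
      ⋁        : Pred Carrier a → Carrier
      ⋁-mem    : ∀ P → mem (⋁ P)
      ⋁-upper  : ∀ P x → mem x → P x → x ≤ ⋁ P
      ⋁-least  : ∀ P y → mem y → (∀ x → mem x → P x → x ≤ y) → ⋁ P ≤ y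
      ⋀        : Pred Carrier a → Carrier
      ⋀-mem    : ∀ P → mem (⋀ P)
      ⋀-lower  : ∀ P x → mem x → P x → ⋀ P ≤ x
      ⋀-great  : ∀ P y → mem y → (∀ x → mem x → P x → y ≤ x) → y ≤ ⋀ P

  SameSub : CSL → CSL → Set a
  SameSub S T = ∀ x → CSL.mem S x ⇔ CSL.mem T x

  -- Down-interpretation a^{L'}: join in L' of {x ∈ L' : x ≤ a}
  -- (the least element of L' when this set is empty).
  down : CSL → Carrier → Carrier
  down S y = CSL.⋁ S (λ x → x ≤ y)

  record Structure : Set (suc a) where
    field
      W     : Set a
      R     : Rel W a
      lat   : W → CSL
      s     : W → Var → Carrier
      s-mem : ∀ w p → CSL.mem (lat w) (s w p)

  module Valuation (neg : Carrier → Carrier) (M : Structure) where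
    open Structure M

    boxVal : W → (W → Carrier) → Carrier
    boxVal w f = CSL.⋀ (lat w) (λ x → Σ W (λ u → R w u × x ≈ down (lat w) (f u)))

    v : W → Formula → Carrier
    v w (var p)   = s w p
    v w (¬' φ)    = down (lat w) (neg (v w φ))
    v w (φ ∧' ψ)  = down (lat w) (v w φ ∧ v w ψ)
    v w (φ ∨' ψ)  = down (lat w) (v w φ ∨ v w ψ)
    v w (□ φ)     = boxVal w (λ u → v u φ)
    -- v_w(◇φ) = (−v_w(□¬φ))^{L_w}, with v_u(¬φ) = (−v_u(φ))^{L_u} unfolded
    v w (◇ φ)     = down (lat w) (neg (boxVal w (λ u → down (lat u) (neg (v u φ)))))

  record IsBisimulation (M M' : Structure) (B : Structure.W M → Structure.W M' → Set a) : Set a where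
    private
      module M  = Structure M
      module M' = Structure M'
    field
      same-lat : ∀ {w w'} → B w w' → SameSub (M.lat w) (M'.lat w')
      atomic   : ∀ {w w'} → B w w' → ∀ p → M.s w p ≈ M'.s w' p
      zig      : ∀ {w w'} → B w w' → ∀ {u} → M.R w u →
                 Σ M'.W (λ u' → SameSub (M'.lat u') (M.lat u) × M'.R w' u' × B u u')
      zag      : ∀ {w w'} → B w w' → ∀ {u'} → M'.R w' u' →
                 Σ M.W (λ u → SameSub (M.lat u) (M'.lat u') × M.R w u × B u u')

-- Bisimilar worlds carry the same sublattice, and every clause of the valuation
-- is a down-interpretation, a lattice operation or a meet inside that sublattice
-- of values that are equal by induction.  The only non-local clause is □ (and ◇):
-- zig and zag match every successor of w with a bisimilar successor of w', so the
-- two sets whose meets are taken contain the same elements of the common sublattice.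
module Submission where

open import Defs
open import Level using (Level)
open import Relation.Binary.Lattice.Bundles using (Lattice)
open import Data.Product using (_,_)
open import Function.Bundles using (Equivalence)
import Function.Properties.Equivalence as ⇔
import Relation.Binary.Lattice.Properties.JoinSemilattice as JoinProperties
import Relation.Binary.Lattice.Properties.MeetSemilattice as MeetProperties

module CompleteSublattice {a : Level} (L : Lattice a a a) where
  open Lattice L

  SameSub-sym : ∀ S T → SameSub L S T → SameSub L T S
  SameSub-sym _ _ e x = ⇔.sym (e x)

  ⋁-mono : ∀ S T {P Q} → SameSub L S T → (∀ x → CSL.mem S x → P x → Q x) →
           CSL.⋁ S P ≤ CSL.⋁ T Q
  ⋁-mono S T {P} {Q} e P⊆Q =
    CSL.⋁-least S P _ (Equivalence.from (e _) (CSL.⋁-mem T Q))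
      (λ x x∈S Px → CSL.⋁-upper T Q x (Equivalence.to (e x) x∈S) (P⊆Q x x∈S Px))

  ⋁-cong : ∀ S T {P Q} → SameSub L S T →
           (∀ x → CSL.mem S x → P x → Q x) → (∀ x → CSL.mem T x → Q x → P x) →
           CSL.⋁ S P ≈ CSL.⋁ T Q
  ⋁-cong S T e P⊆Q Q⊆P = antisym (⋁-mono S T e P⊆Q) (⋁-mono T S (SameSub-sym S T e) Q⊆P)

  ⋀-antitone : ∀ S T {P Q} → SameSub L S T → (∀ x → CSL.mem T x → Q x → P x) →
               CSL.⋀ S P ≤ CSL.⋀ T Q
  ⋀-antitone S T {P} {Q} e Q⊆P =
    CSL.⋀-great T Q _ (Equivalence.to (e _) (CSL.⋀-mem S P))
      (λ x x∈T Qx → CSL.⋀-lower S P x (Equivalence.from (e x) x∈T) (Q⊆P x x∈T Qx))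

  ⋀-cong : ∀ S T {P Q} → SameSub L S T →
           (∀ x → CSL.mem S x → P x → Q x) → (∀ x → CSL.mem T x → Q x → P x) →
           CSL.⋀ S P ≈ CSL.⋀ T Q
  ⋀-cong S T e P⊆Q Q⊆P = antisym (⋀-antitone S T e Q⊆P) (⋀-antitone T S (SameSub-sym S T e) P⊆Q)

  down-cong : ∀ S T {y y'} → SameSub L S T → y ≈ y' → down L S y ≈ down L T y'
  down-cong S T e y≈y' = ⋁-cong S T e
    (λ _ _ x≤y → trans x≤y (reflexive y≈y'))
    (λ _ _ x≤y' → trans x≤y' (reflexive (Eq.sym y≈y')))

module Invariance {a : Level} (L : Lattice a a a) (neg : Lattice.Carrier L → Lattice.Carrier L)
    (neg-cong : ∀ {x y} → Lattice._≈_ L x y → Lattice._≈_ L (neg x) (neg y))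
    (M M' : Structure L) (B : Structure.W M → Structure.W M' → Set a)
    (bisim : IsBisimulation L M M' B) where
  open Lattice L
  open CompleteSublattice L
  open IsBisimulation bisim
  open JoinProperties joinSemilattice using (∨-cong)
  open MeetProperties meetSemilattice using (∧-cong)
  private
    module M  = Structure M
    module M' = Structure M'
    module V  = Valuation L neg M
    module V' = Valuation L neg M'

  down-cong-bisimilar : ∀ {w w'} → B w w' → ∀ {y y'} → y ≈ y' →
                        down L (M.lat w) y ≈ down L (M'.lat w') y'
  down-cong-bisimilar {w} {w'} b = down-cong (M.lat w) (M'.lat w') (same-lat b)

  boxVal-cong : ∀ {w w'} → B w w' → (f : M.W → Carrier) (f' : M'.W → Carrier) →
                (∀ {u u'} → B u u' → f u ≈ f' u') →
                V.boxVal w f ≈ V'.boxVal w' f'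
  boxVal-cong {w} {w'} b f f' f≈f' = ⋀-cong (M.lat w) (M'.lat w') (same-lat b)
    (λ { _ _ (u , wRu , x≈fu) → let (u' , _ , w'Ru' , b') = zig b wRu in
           u' , w'Ru' , Eq.trans x≈fu (down-cong-bisimilar b (f≈f' b')) })
    (λ { _ _ (u' , w'Ru' , x≈f'u') → let (u , _ , wRu , b') = zag b w'Ru' in
           u , wRu , Eq.trans x≈f'u' (Eq.sym (down-cong-bisimilar b (f≈f' b'))) })

  v-invariant : ∀ {w w'} → B w w' → (φ : Formula) → V.v w φ ≈ V'.v w' φ
  v-invariant b (var p)  = atomic b p
  v-invariant b (¬' φ)   = down-cong-bisimilar b (neg-cong (v-invariant b φ))
  v-invariant b (φ ∧' ψ) = down-cong-bisimilar b (∧-cong (v-invariant b φ) (v-invariant b ψ))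
  v-invariant b (φ ∨' ψ) = down-cong-bisimilar b (∨-cong (v-invariant b φ) (v-invariant b ψ))
  v-invariant b (□ φ)    = boxVal-cong b _ _ (λ b' → v-invariant b' φ)
  v-invariant b (◇ φ)    = down-cong-bisimilar b (neg-cong (boxVal-cong b _ _
    (λ b' → down-cong-bisimilar b' (neg-cong (v-invariant b' φ)))))

mainTheorem1 : {a : Level} (L : Lattice a a a) (neg : Lattice.Carrier L → Lattice.Carrier L)
    → (∀ {x y} → Lattice._≈_ L x y → Lattice._≈_ L (neg x) (neg y))
    → (M M' : Structure L) (B : Structure.W M → Structure.W M' → Set a)
    → IsBisimulation L M M' B
    → ∀ {w w'} → B w w' → (φ : Formula)
    → Lattice._≈_ L (Valuation.v L neg M w φ) (Valuation.v L neg M' w' φ)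
mainTheorem1 L neg neg-cong M M' B bisim = Invariance.v-invariant L neg neg-cong M M' B bisim
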